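{- Let $R$ be a commutative ring, $V$ a free $R$-module of rank $n$, $G=\mathrm{Aut}_R(V)$, and $\tau\in\mathrm{End}_R(V)$. Let $\mathcal F$ be a decorated flag with respect to which $\tau$ is subcyclic, and let $\mathcal B$ be any ordered basis giving rise to $\mathcal F$. Then there is a unique element of $\{u\tau u^{ -1}:u\in N_{\mathcal F}\}$ that is cyclic with respect to $\mathcal B$.
   Context: A decorated flag is given by an ordered basis $(e_1,\dots,e_n)$ of $V$, two ordered bases giving the same decorated flag iff $e'_j-e_j\in\langle e_1,\dots,e_{j-1}\rangle$ for all $j$ (equivalently: the flag $V_j=\langle e_1,\dots,e_j\rangle$ together with the images of $e_j$ in $V_j/V_{j-1}$). $N_{\mathcal F}\le G$ is the stabilizer of $\mathcal F$. $\tau$ is subcyclic with respect to $\mathcal F$ if for a basis $(e_j)$ giving $\mathcal F$, $\tau e_j-e_{j+1}\in\langle e_1,\dots,e_j\rangle$ for $1\le j\le n-1$. $\tau$ is cyclic with respect to an ordered basis $(e_j)$ if $\tau e_j=e_{j+1}$ for $1\le j\le n-1$. -}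

module Defs where

open import Level using (_⊔_)
open import Algebra.Bundles using (CommutativeRing)
open import Data.Nat using (ℕ; zero; suc; _≤_)
open import Data.Fin using (Fin; toℕ) renaming (zero to fzero; suc to fsuc)
open import Data.Product using (Σ; ∃; _×_)
open import Relation.Binary.PropositionalEquality using (_≡_)

-- Everything is parametrised by a commutative ring R.
-- The free R-module V of rank n is modelled as R^n = (Fin n → Carrier).
module _ {c ℓ} (R : CommutativeRing c ℓ) where
  open CommutativeRing R

  Vect : ℕ → Set c
  Vect n = Fin n → Carrier

  _≈ᵥ_ : ∀ {n} → Vect n → Vect n → Set ℓ
  v ≈ᵥ w = ∀ k → v k ≈ w k

  _+ᵥ_ : ∀ {n} → Vect n → Vect n → Vect n
  (v +ᵥ w) k = v k + w k

  _-ᵥ_ : ∀ {n} → Vect n → Vect n → Vect n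
  (v -ᵥ w) k = v k - w k

  _·ᵥ_ : ∀ {n} → Carrier → Vect n → Vect n
  (r ·ᵥ v) k = r * v k

  sumR : ∀ {m} → (Fin m → Carrier) → Carrier
  sumR {zero}  f = 0#
  sumR {suc m} f = f fzero + sumR (λ i → f (fsuc i))

  Frame : ℕ → Set c
  Frame n = Fin n → Vect n

  lincomb : ∀ {n} → (Fin n → Carrier) → Frame n → Vect n
  lincomb a e k = sumR (λ i → a i * e i k)

  IsBasis : ∀ {n} → Frame n → Set (c ⊔ ℓ)
  IsBasis {n} e =
    ((v : Vect n) → Σ (Fin n → Carrier) λ a → v ≈ᵥ lincomb a e)
    × (∀ (a b : Fin n → Carrier) → lincomb a e ≈ᵥ lincomb b e → ∀ i → a i ≈ b i)

  InSpan : ∀ {n} → ℕ → Frame n → Vect n → Set (c ⊔ ℓ)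
  InSpan {n} m e v =
    Σ (Fin n → Carrier) λ a → (∀ i → m ≤ toℕ i → a i ≈ 0#) × (v ≈ᵥ lincomb a e)

  -- the bases e and e' give the same decorated flag:
  -- e'_j - e_j ∈ ⟨e_1, …, e_{j-1}⟩ for all j
  SameFlag : ∀ {n} → Frame n → Frame n → Set (c ⊔ ℓ)
  SameFlag e e' = ∀ j → InSpan (toℕ j) e (e' j -ᵥ e j)

  record End (n : ℕ) : Set (c ⊔ ℓ) where
    field
      fun   : Vect n → Vect n
      cong  : ∀ {v w} → v ≈ᵥ w → fun v ≈ᵥ fun w
      +-hom : ∀ v w → fun (v +ᵥ w) ≈ᵥ (fun v +ᵥ fun w)
      ·-hom : ∀ r v → fun (r ·ᵥ v) ≈ᵥ (r ·ᵥ fun v)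
  open End public

  _≈ₑ_ : ∀ {n} → End n → End n → Set (c ⊔ ℓ)
  σ ≈ₑ σ' = ∀ v → fun σ v ≈ᵥ fun σ' v

  record Aut (n : ℕ) : Set (c ⊔ ℓ) where
    field
      to    : End n
      from  : End n
      to∘from : ∀ v → fun to (fun from v) ≈ᵥ v
      from∘to : ∀ v → fun from (fun to v) ≈ᵥ v
  open Aut public

  -- N_F: stabilizer of the decorated flag F represented by the basis e,
  -- i.e. u·F = F where u·F is given by the basis (u e_j)
  InStab : ∀ {n} → Frame n → Aut n → Set (c ⊔ ℓ)
  InStab e u = SameFlag e (λ j → fun (to u) (e j))

  InConjClass : ∀ {n} → Frame n → End n → End n → Set (c ⊔ ℓ)
  InConjClass {n} e τ σ =
    Σ (Aut n) λ u → InStab e u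
      × (∀ v → fun σ v ≈ᵥ fun (to u) (fun τ (fun (from u) v)))

  -- τ subcyclic w.r.t. the flag of e: τ e_j - e_{j+1} ∈ ⟨e_1, …, e_j⟩, 1 ≤ j ≤ n-1
  -- (0-indexed: for i, i' with toℕ i' = toℕ i + 1, τ e_i - e_{i'} ∈ span of e_0..e_i)
  Subcyclic : ∀ {n} → End n → Frame n → Set (c ⊔ ℓ)
  Subcyclic τ e =
    ∀ i i' → toℕ i' ≡ suc (toℕ i) → InSpan (suc (toℕ i)) e (fun τ (e i) -ᵥ e i')

  Cyclic : ∀ {n} → End n → Frame n → Set ℓ
  Cyclic τ e = ∀ i i' → toℕ i' ≡ suc (toℕ i) → fun τ (e i) ≈ᵥ e i'

-- Let e be the τ-orbit of B₀, eᵢ = τⁱ B₀. Subcyclicity of τ gives eⱼ − fⱼ ∈ ⟨f₀, …, f_{j−1}⟩, so e is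
-- a basis (a unitriangular frame is inverted by back-substitution) giving the same decorated flag as f.
-- The automorphism u with u eᵢ = Bᵢ therefore lies in N_F, and u τ u⁻¹ sends Bᵢ to B_{i+1}.
-- Conversely, if w ∈ N_F and w τ w⁻¹ is cyclic with respect to B, then w⁻¹B is a τ-cyclic frame with
-- w⁻¹B₀ = B₀ (w fixes f₀ = B₀), hence w⁻¹B = e; so w⁻¹ = u⁻¹ on the basis B and w τ w⁻¹ = u τ u⁻¹.

module Submission where

open import Defs
open import Algebra.Bundles using (CommutativeRing)
open import Data.Fin using (Fin; toℕ; inject₁; fromℕ; fromℕ<; _<_; _>_)
  renaming (zero to fzero; suc to fsuc)
open import Data.Fin.Induction using (<-weakInduction; >-weakInduction; >-wellFounded)
open import Data.Fin.Properties
  using (_≟_; <-cmp; toℕ<n; ≤∧≢⇒<; <⇒≢; toℕ-inject₁; toℕ-fromℕ; toℕ-fromℕ<; punchInᵢ≢i)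
open import Data.Nat using (ℕ; zero; suc; z≤n)
import Data.Nat as ℕ
open import Data.Nat.GeneralisedArithmetic using (fold)
import Data.Nat.Properties as ℕ
open import Data.Product using (Σ; _×_; _,_; proj₁; proj₂)
open import Data.Sum using (_⊎_; inj₁; inj₂)
open import Data.Vec.Functional using (removeAt)
open import Function using (_∘_)
open import Level using (_⊔_)
open import Induction.WellFounded using (module All)
open import Relation.Binary.Definitions using (tri<; tri≈; tri>)
import Relation.Binary.PropositionalEquality as ≡
import Relation.Binary.Reasoning.Setoid as SetoidReasoning
open import Relation.Nullary using (yes; no)
open import Relation.Nullary.Negation using (contradiction)

module _ {c ℓ} (R : CommutativeRing c ℓ) where
  open CommutativeRing R
  open import Algebra.Properties.Ring ring using (-1*x≈-x)
  open import Algebra.Properties.Group +-group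
    using (∙-cancelʳ; x∙y⁻¹≈ε⇒x≈y; x≈y⇒x∙y⁻¹≈ε; //-rightDividesˡ)
  open import Algebra.Properties.Semiring.Sum semiring
    using (sum; sum-cong-≋; ∑-distrib-+; *-distribˡ-sum; sum-remove; sum-replicate-zero)
  open import Data.Vec.Functional.Relation.Binary.Equality.Setoid setoid
    using (_≋_; ≋-refl; ≋-sym; ≋-trans; ≋-reflexive; ≋-setoid)

  private
    variable
      m n : ℕ

  module ≈-Reasoning = SetoidReasoning setoid
  module ≋-Reasoning {n : ℕ} = SetoidReasoning (≋-setoid n)

  sumR≡sum : (g : Fin m → Carrier) → sumR R g ≡.≡ sum g
  sumR≡sum {zero}  g = ≡.refl
  sumR≡sum {suc m} g = ≡.cong (g fzero +_) (sumR≡sum (g ∘ fsuc))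

  sum-zero : {g : Fin m → Carrier} → (∀ i → g i ≈ 0#) → sum g ≈ 0#
  sum-zero {m} g≈0 = trans (sum-cong-≋ g≈0) (sum-replicate-zero m)

  sum-pick : {g : Fin m → Carrier} (i : Fin m) → (∀ j → j ≡.≢ i → g j ≈ 0#) → sum g ≈ g i
  sum-pick {suc m} {g} i g≈0 = begin
    sum g                        ≈⟨ sum-remove g ⟩
    g i + sum (removeAt g i)     ≈⟨ +-congˡ (sum-zero (λ j → g≈0 _ (punchInᵢ≢i i j))) ⟩
    g i + 0#                     ≈⟨ +-identityʳ (g i) ⟩
    g i                          ∎
    where open ≈-Reasoning

  sum-agree-at : {g h : Fin m → Carrier} (i : Fin m) →
    (∀ j → j ≡.≢ i → g j ≈ h j) → sum g ≈ sum h → g i ≈ h i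
  sum-agree-at {suc m} {g} {h} i g≈h Σg≈Σh = ∙-cancelʳ (sum (removeAt g i)) (g i) (h i) (begin
    g i + sum (removeAt g i)     ≈⟨ sum-remove g ⟨
    sum g                        ≈⟨ Σg≈Σh ⟩
    sum h                        ≈⟨ sum-remove h ⟩
    h i + sum (removeAt h i)     ≈⟨ +-congˡ (sum-cong-≋ (λ j → g≈h _ (punchInᵢ≢i i j))) ⟨
    h i + sum (removeAt g i)     ∎)
    where open ≈-Reasoning

  *-cong-zeroʳ : ∀ {x y z} → z ≈ 0# → x * z ≈ y * z
  *-cong-zeroʳ {x} {y} z≈0 =
    trans (*-congˡ z≈0) (trans (zeroʳ x) (sym (trans (*-congˡ z≈0) (zeroʳ y))))

  δ : Fin m → Fin m → Carrier
  δ j i with i ≟ j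
  ... | yes _ = 1#
  ... | no  _ = 0#

  δ-diag : (j : Fin m) → δ j j ≈ 1#
  δ-diag j with j ≟ j
  ... | yes _   = refl
  ... | no  j≢j = contradiction ≡.refl j≢j

  δ-off : {i j : Fin m} → i ≡.≢ j → δ j i ≈ 0#
  δ-off {i = i} {j} i≢j with i ≟ j
  ... | yes i≡j = contradiction i≡j i≢j
  ... | no  _   = refl

  𝟎 : Vect R n
  𝟎 _ = 0#

  lc : (Fin m → Carrier) → (Fin m → Vect R n) → Vect R n
  lc a X k = sum (λ i → a i * X i k)

  lincomb≋lc : (a : Fin n → Carrier) (e : Frame R n) → lincomb R a e ≋ lc a e
  lincomb≋lc a e k = reflexive (sumR≡sum (λ i → a i * e i k))

  lc-cong : {a b : Fin m → Carrier} {X Y : Fin m → Vect R n} →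
    (∀ i → a i ≈ b i) → (∀ i → X i ≋ Y i) → lc a X ≋ lc b Y
  lc-cong a≈b X≋Y k = sum-cong-≋ (λ i → *-cong (a≈b i) (X≋Y i k))

  lc-+ : (a b : Fin m → Carrier) (X : Fin m → Vect R n) →
    lc (λ i → a i + b i) X ≋ _+ᵥ_ R (lc a X) (lc b X)
  lc-+ a b X k = trans (sum-cong-≋ (λ i → distribʳ (X i k) (a i) (b i)))
                       (∑-distrib-+ (λ i → a i * X i k) (λ i → b i * X i k))

  lc-* : (r : Carrier) (a : Fin m → Carrier) (X : Fin m → Vect R n) →
    lc (λ i → r * a i) X ≋ _·ᵥ_ R r (lc a X)
  lc-* r a X k =
    trans (sum-cong-≋ (λ i → *-assoc r (a i) (X i k))) (sym (*-distribˡ-sum r (λ i → a i * X i k)))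

  lc-δ : (j : Fin m) (X : Fin m → Vect R n) → lc (δ j) X ≋ X j
  lc-δ j X k = trans (sum-pick j (λ i i≢j → trans (*-congʳ (δ-off i≢j)) (zeroˡ _)))
                     (trans (*-congʳ (δ-diag j)) (*-identityˡ _))

  lc-+-δ : (a : Fin m → Carrier) (r : Carrier) (j : Fin m) (X : Fin m → Vect R n) →
    lc (λ i → a i + r * δ j i) X ≋ _+ᵥ_ R (lc a X) (_·ᵥ_ R r (X j))
  lc-+-δ a r j X k =
    trans (lc-+ a _ X k) (+-congˡ (trans (lc-* r (δ j) X k) (*-congˡ (lc-δ j X k))))

  idᴱ : End R n
  idᴱ = record
    { fun = λ v → v ; cong = λ v≋w → v≋w ; +-hom = λ _ _ → ≋-refl ; ·-hom = λ _ _ → ≋-refl }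

  infixr 9 _∘ᴱ_
  _∘ᴱ_ : End R n → End R n → End R n
  σ ∘ᴱ ρ = record
    { fun   = fun σ ∘ fun ρ
    ; cong  = cong σ ∘ cong ρ
    ; +-hom = λ v w → ≋-trans (cong σ (+-hom ρ v w)) (+-hom σ _ _)
    ; ·-hom = λ r v → ≋-trans (cong σ (·-hom ρ r v)) (·-hom σ r _)
    }

  End-𝟎 : (σ : End R n) → fun σ 𝟎 ≋ 𝟎
  End-𝟎 σ = ≋-trans (cong σ (λ _ → sym (zeroˡ 0#)))
                    (≋-trans (·-hom σ 0# 𝟎) (λ _ → zeroˡ _))

  End-⊖ : (σ : End R n) (v w : Vect R n) → fun σ (_-ᵥ_ R v w) ≋ _-ᵥ_ R (fun σ v) (fun σ w)
  End-⊖ σ v w = ≋-trans (cong σ (λ k → +-congˡ (sym (-1*x≈-x (w k)))))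
    (≋-trans (+-hom σ v _) (λ k → +-congˡ (trans (·-hom σ (- 1#) w k) (-1*x≈-x _))))

  End-lc : (σ : End R n) (a : Fin m → Carrier) (X : Fin m → Vect R n) →
    fun σ (lc a X) ≋ lc a (fun σ ∘ X)
  End-lc {m = zero}  σ a X = End-𝟎 σ
  End-lc {m = suc m} σ a X = ≋-trans (+-hom σ _ (lc (a ∘ fsuc) (X ∘ fsuc)))
    (λ k → +-cong (·-hom σ (a fzero) (X fzero) k) (End-lc σ (a ∘ fsuc) (X ∘ fsuc) k))

  lcᴱ : Frame R n → End R n
  lcᴱ X = record
    { fun   = λ a → lc a X
    ; cong  = λ a≈b → lc-cong a≈b (λ _ → ≋-refl)
    ; +-hom = λ a b → lc-+ a b X
    ; ·-hom = λ r a → lc-* r a X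
    }

  module Coordinates {n} {e : Frame R n} (e-basis : IsBasis R e) where

    coord : Vect R n → Fin n → Carrier
    coord v = proj₁ (proj₁ e-basis v)

    coord-spec : ∀ v → v ≋ lc (coord v) e
    coord-spec v = ≋-trans (proj₂ (proj₁ e-basis v)) (lincomb≋lc (coord v) e)

    coord-unique : ∀ {v} a → v ≋ lc a e → ∀ i → coord v i ≈ a i
    coord-unique {v} a v≋ = proj₂ e-basis (coord v) a
      (≋-trans (≋-sym (proj₂ (proj₁ e-basis v))) (≋-trans v≋ (≋-sym (lincomb≋lc a e))))

    coordinates : End R n
    coordinates = record
      { fun   = coord
      ; cong  = λ {_} {w} v≋w → coord-unique (coord w) (≋-trans v≋w (coord-spec w))
      ; +-hom = λ v w → coord-unique _
          (≋-trans (λ k → +-cong (coord-spec v k) (coord-spec w k)) (≋-sym (lc-+ (coord v) (coord w) e)))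
      ; ·-hom = λ r v → coord-unique _
          (≋-trans (λ k → *-congˡ (coord-spec v k)) (≋-sym (lc-* r (coord v) e)))
      }

    coord-basis : ∀ j → coord (e j) ≋ δ j
    coord-basis j = coord-unique (δ j) (≋-sym (lc-δ j e))

    extend : Frame R n → End R n
    extend X = lcᴱ X ∘ᴱ coordinates

    extend-basis : ∀ X j → fun (extend X) (e j) ≋ X j
    extend-basis X j = ≋-trans (lc-cong (coord-basis j) (λ _ → ≋-refl)) (lc-δ j X)

    End-ext : (σ ρ : End R n) → (∀ j → fun σ (e j) ≋ fun ρ (e j)) → _≈ₑ_ R σ ρ
    End-ext σ ρ σe≋ρe v = begin
      fun σ v                   ≈⟨ cong σ (coord-spec v) ⟩
      fun σ (lc (coord v) e)    ≈⟨ End-lc σ (coord v) e ⟩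
      lc (coord v) (fun σ ∘ e)  ≈⟨ lc-cong (λ _ → refl) σe≋ρe ⟩
      lc (coord v) (fun ρ ∘ e)  ≈⟨ End-lc ρ (coord v) e ⟨
      fun ρ (lc (coord v) e)    ≈⟨ cong ρ (coord-spec v) ⟨
      fun ρ v                   ∎
      where open ≋-Reasoning

  basisChange : {e X : Frame R n} → IsBasis R e → IsBasis R X → Aut R n
  basisChange {e = e} {X} e-basis X-basis = record
    { to      = E.extend X
    ; from    = X′.extend e
    ; to∘from = X′.End-ext (E.extend X ∘ᴱ X′.extend e) idᴱ
        (λ j → ≋-trans (cong (E.extend X) (X′.extend-basis e j)) (E.extend-basis X j))
    ; from∘to = E.End-ext (X′.extend e ∘ᴱ E.extend X) idᴱ
        (λ j → ≋-trans (cong (X′.extend e) (E.extend-basis X j)) (X′.extend-basis e j))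
    }
    where
    module E  = Coordinates e-basis
    module X′ = Coordinates X-basis

  module Flag {n} {f : Frame R n} (f-basis : IsBasis R f) where
    open Coordinates f-basis

    -- x ∼[ m ] y encodes x − y ∈ ⟨f₀, …, f_{m−1}⟩ as agreement of the f-coordinates from m on.
    infix 4 _∼[_]_
    _∼[_]_ : Vect R n → ℕ → Vect R n → Set ℓ
    x ∼[ m ] y = ∀ k → m ℕ.≤ toℕ k → coord x k ≈ coord y k

    ∼-sym : ∀ {x y m} → x ∼[ m ] y → y ∼[ m ] x
    ∼-sym x∼y k m≤k = sym (x∼y k m≤k)

    ∼-trans : ∀ {x y z m} → x ∼[ m ] y → y ∼[ m ] z → x ∼[ m ] z
    ∼-trans x∼y y∼z k m≤k = trans (x∼y k m≤k) (y∼z k m≤k)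

    ≋⇒∼ : ∀ {x y m} → x ≋ y → x ∼[ m ] y
    ≋⇒∼ x≋y k _ = cong coordinates x≋y k

    ∼-mono : ∀ {x y m m′} → m ℕ.≤ m′ → x ∼[ m ] y → x ∼[ m′ ] y
    ∼-mono m≤m′ x∼y k m′≤k = x∼y k (ℕ.≤-trans m≤m′ m′≤k)

    ∼-top : ∀ {x y m} → n ℕ.≤ m → x ∼[ m ] y
    ∼-top n≤m k m≤k = contradiction (ℕ.≤-trans n≤m m≤k) (ℕ.<⇒≱ (toℕ<n k))

    ∼[0]⇒≋ : ∀ {x y} → x ∼[ 0 ] y → x ≋ y
    ∼[0]⇒≋ {x} {y} x∼y =
      ≋-trans (coord-spec x)
        (≋-trans (lc-cong (λ i → x∼y i z≤n) (λ _ → ≋-refl)) (≋-sym (coord-spec y)))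

    coord-⊖ : ∀ x y k → coord (_-ᵥ_ R x y) k ≈ coord x k - coord y k
    coord-⊖ x y = End-⊖ coordinates x y

    InSpan⇒∼ : ∀ {x y m} → InSpan R m f (_-ᵥ_ R x y) → x ∼[ m ] y
    InSpan⇒∼ {x} {y} (a , a≈0 , x-y≋) k m≤k = x∙y⁻¹≈ε⇒x≈y _ _ (begin
      coord x k - coord y k     ≈⟨ coord-⊖ x y k ⟨
      coord (_-ᵥ_ R x y) k      ≈⟨ coord-unique a (≋-trans x-y≋ (lincomb≋lc a f)) k ⟩
      a k                       ≈⟨ a≈0 k m≤k ⟩
      0#                        ∎)
      where open ≈-Reasoning

    ∼⇒InSpan : ∀ {x y m} → x ∼[ m ] y → InSpan R m f (_-ᵥ_ R x y)
    ∼⇒InSpan {x} {y} x∼y =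
      coord (_-ᵥ_ R x y) ,
      (λ k m≤k → trans (coord-⊖ x y k) (x≈y⇒x∙y⁻¹≈ε (x∼y k m≤k))) ,
      ≋-trans (coord-spec _) (≋-sym (lincomb≋lc _ f))

    Adapted : Frame R n → Set ℓ
    Adapted e = ∀ j → e j ∼[ toℕ j ] f j

    sameFlag⇒adapted : ∀ {e} → SameFlag R f e → Adapted e
    sameFlag⇒adapted f~e j = InSpan⇒∼ (f~e j)

    adapted⇒sameFlag : ∀ {e} → Adapted e → SameFlag R f e
    adapted⇒sameFlag e-adapted j = ∼⇒InSpan (e-adapted j)

    coord-𝟎 : ∀ k → coord 𝟎 k ≈ 0#
    coord-𝟎 = End-𝟎 coordinates

    adapted-diag : ∀ {e} → Adapted e → ∀ i → coord (e i) i ≈ 1#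
    adapted-diag e-adapted i = trans (e-adapted i i ℕ.≤-refl) (trans (coord-basis i i) (δ-diag i))

    adapted-below : ∀ {e} → Adapted e → ∀ i → e i ∼[ suc (toℕ i) ] 𝟎
    adapted-below {e} e-adapted i k i<k = begin
      coord (e i) k   ≈⟨ e-adapted i k (ℕ.<⇒≤ i<k) ⟩
      coord (f i) k   ≈⟨ coord-basis i k ⟩
      δ i k           ≈⟨ δ-off (<⇒≢ i<k ∘ ≡.sym) ⟩
      0#              ≈⟨ coord-𝟎 k ⟨
      coord 𝟎 k       ∎
      where open ≈-Reasoning

    lc-∼ : ∀ {m′ m} {a b : Fin m′ → Carrier} {X : Fin m′ → Vect R n} →
      (∀ i → a i ≈ b i ⊎ X i ∼[ m ] 𝟎) → lc a X ∼[ m ] lc b X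
    lc-∼ {m = m} {a} {b} {X} agree-or-below k m≤k = begin
      coord (lc a X) k                  ≈⟨ End-lc coordinates a X k ⟩
      sum (λ i → a i * coord (X i) k)  ≈⟨ sum-cong-≋ (λ i → term i (agree-or-below i)) ⟩
      sum (λ i → b i * coord (X i) k)  ≈⟨ End-lc coordinates b X k ⟨
      coord (lc b X) k                  ∎
      where
      open ≈-Reasoning
      term : ∀ i → a i ≈ b i ⊎ X i ∼[ m ] 𝟎 → a i * coord (X i) k ≈ b i * coord (X i) k
      term i (inj₁ a≈b) = *-congʳ a≈b
      term i (inj₂ X∼𝟎) = *-cong-zeroʳ (trans (X∼𝟎 k m≤k) (coord-𝟎 k))

    -- d = 0 serves frames adapted to f, d = 1 the images τ fᵢ under a subcyclic τ.
    lc-∼-triangular : ∀ d {m} {a b : Fin n → Carrier} {X : Frame R n} →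
      (∀ i → X i ∼[ d ℕ.+ suc (toℕ i) ] 𝟎) → (∀ i → m ℕ.≤ toℕ i → a i ≈ b i) →
      lc a X ∼[ d ℕ.+ m ] lc b X
    lc-∼-triangular d {m} {a} {b} {X} X-below a≈b = lc-∼ agree-or-below
      where
      agree-or-below : ∀ i → a i ≈ b i ⊎ X i ∼[ d ℕ.+ m ] 𝟎
      agree-or-below i with m ℕ.≤? toℕ i
      ... | yes m≤i = inj₁ (a≈b i m≤i)
      ... | no  m≰i = inj₂ (∼-mono (ℕ.+-monoʳ-≤ d (ℕ.≰⇒> m≰i)) (X-below i))

    -- Descending induction on i: the coefficients above i already agree, and e i has f-coordinate 1 at i.
    adapted-lc-∼⁻¹ : ∀ {e m} {a b : Fin n → Carrier} → Adapted e →
      lc a e ∼[ m ] lc b e → ∀ i → m ℕ.≤ toℕ i → a i ≈ b i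
    adapted-lc-∼⁻¹ {e} {m} {a} {b} e-adapted lca∼lcb = All.wfRec >-wellFounded ℓ P step
      where
      P : Fin n → Set ℓ
      P i = m ℕ.≤ toℕ i → a i ≈ b i

      step : ∀ i → (∀ {j} → j > i → P j) → P i
      step i above m≤i = begin
        a i                  ≈⟨ *-identityʳ (a i) ⟨
        a i * 1#             ≈⟨ *-congˡ (adapted-diag e-adapted i) ⟨
        a i * coord (e i) i  ≈⟨ sum-agree-at i off-diagonal sums ⟩
        b i * coord (e i) i  ≈⟨ *-congˡ (adapted-diag e-adapted i) ⟩
        b i * 1#             ≈⟨ *-identityʳ (b i) ⟩
        b i                  ∎
        where
        open ≈-Reasoning
        sums : sum (λ j → a j * coord (e j) i) ≈ sum (λ j → b j * coord (e j) i)
        sums = trans (sym (End-lc coordinates a e i))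
                     (trans (lca∼lcb i m≤i) (End-lc coordinates b e i))
        off-diagonal : ∀ j → j ≡.≢ i → a j * coord (e j) i ≈ b j * coord (e j) i
        off-diagonal j j≢i with <-cmp j i
        ... | tri< j<i _ _ = *-cong-zeroʳ (trans (adapted-below e-adapted j i j<i) (coord-𝟎 i))
        ... | tri≈ _ j≡i _ = contradiction j≡i j≢i
        ... | tri> _ _ i<j = *-congʳ (above i<j (ℕ.≤-trans m≤i (ℕ.<⇒≤ i<j)))

    adapted-adjust : ∀ {e x y} → Adapted e → ∀ i → x ∼[ suc (toℕ i) ] y →
      x ∼[ toℕ i ] _+ᵥ_ R y (_·ᵥ_ R (coord x i - coord y i) (e i))
    adapted-adjust {e} {x} {y} e-adapted i x∼y k i≤k =
      sym (trans (+-hom coordinates y _ k) (trans (+-congˡ (·-hom coordinates r (e i) k)) at))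
      where
      r = coord x i - coord y i
      at : coord y k + r * coord (e i) k ≈ coord x k
      at with i ≟ k
      ... | yes ≡.refl = begin
        coord y i + r * coord (e i) i  ≈⟨ +-congˡ (*-congˡ (adapted-diag e-adapted i)) ⟩
        coord y i + r * 1#             ≈⟨ +-congˡ (*-identityʳ r) ⟩
        coord y i + r                  ≈⟨ +-comm (coord y i) r ⟩
        r + coord y i                  ≈⟨ //-rightDividesˡ (coord y i) (coord x i) ⟩
        coord x i                      ∎
        where open ≈-Reasoning
      ... | no  i≢k = begin
        coord y k + r * coord (e i) k  ≈⟨ +-congˡ (*-congˡ (adapted-below e-adapted i k i<k)) ⟩
        coord y k + r * coord 𝟎 k      ≈⟨ +-congˡ (*-congˡ (coord-𝟎 k)) ⟩
        coord y k + r * 0#             ≈⟨ +-congˡ (zeroʳ r) ⟩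
        coord y k + 0#                 ≈⟨ +-identityʳ (coord y k) ⟩
        coord y k                      ≈⟨ x∼y k i<k ⟨
        coord x k                      ∎
        where
        open ≈-Reasoning
        i<k : i < k
        i<k = ≤∧≢⇒< i≤k i≢k

    -- Back-substitution: fix the coefficients of e_{n−1}, …, e_0 one at a time, top-down.
    adapted-spans : ∀ {e} → Adapted e → ∀ x → Σ (Fin n → Carrier) λ a → x ≋ lc a e
    adapted-spans {e} e-adapted x = proj₁ solution , ∼[0]⇒≋ (proj₂ solution)
      where
      P : Fin (suc n) → Set (c ⊔ ℓ)
      P i = Σ (Fin n → Carrier) λ a → x ∼[ toℕ i ] lc a e

      none-fixed : P (fromℕ n)
      none-fixed = (λ _ → 0#) , ∼-top (ℕ.≤-reflexive (≡.sym (toℕ-fromℕ n)))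

      fix-next : ∀ i → P (fsuc i) → P (inject₁ i)
      fix-next i (a , x∼lca) = (λ j → a j + r * δ i j) ,
        ≡.subst (λ m → x ∼[ m ] lc (λ j → a j + r * δ i j) e) (≡.sym (toℕ-inject₁ i))
          (∼-trans (adapted-adjust e-adapted i x∼lca) (≋⇒∼ (≋-sym (lc-+-δ a r i e))))
        where r = coord x i - coord (lc a e) i

      solution : P fzero
      solution = >-weakInduction P none-fixed fix-next fzero

    adapted⇒isBasis : ∀ {e} → Adapted e → IsBasis R e
    adapted⇒isBasis {e} e-adapted =
      (λ x → let (a , x≋lca) = adapted-spans e-adapted x
             in a , ≋-trans x≋lca (≋-sym (lincomb≋lc a e))) ,
      λ a b lca≋lcb i → adapted-lc-∼⁻¹ e-adapted
        (≋⇒∼ (≋-trans (≋-sym (lincomb≋lc a e)) (≋-trans lca≋lcb (lincomb≋lc b e)))) i z≤n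

    -- Both frames span the same flag, so the map e_j ↦ X_j preserves every step of it.
    extend-∼ : ∀ {e X} (e-basis : IsBasis R e) → Adapted e → Adapted X → ∀ {x y m} →
      x ∼[ m ] y → fun (Coordinates.extend e-basis X) x ∼[ m ] fun (Coordinates.extend e-basis X) y
    extend-∼ {e} e-basis e-adapted X-adapted {x} {y} x∼y =
      lc-∼-triangular 0 (adapted-below X-adapted) (adapted-lc-∼⁻¹ e-adapted lc∼lc)
      where
      module E = Coordinates e-basis
      lc∼lc : lc (E.coord x) e ∼[ _ ] lc (E.coord y) e
      lc∼lc = ∼-trans (≋⇒∼ (≋-sym (E.coord-spec x))) (∼-trans x∼y (≋⇒∼ (E.coord-spec y)))

    basisChange-stabilises : ∀ {e X} (e-basis : IsBasis R e) (X-basis : IsBasis R X) →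
      Adapted e → Adapted X → InStab R f (basisChange e-basis X-basis)
    basisChange-stabilises {X = X} e-basis X-basis e-adapted X-adapted = adapted⇒sameFlag λ j →
      ∼-trans (extend-∼ e-basis e-adapted X-adapted (∼-sym (e-adapted j)))
        (∼-trans (≋⇒∼ (Coordinates.extend-basis e-basis X j)) (X-adapted j))

    subcyclic-below : ∀ {τ} → Subcyclic R τ f → ∀ i → fun τ (f i) ∼[ 1 ℕ.+ suc (toℕ i) ] 𝟎
    subcyclic-below sc i with suc (toℕ i) ℕ.<? n
    ... | yes i+1<n =
      ∼-trans (∼-mono (ℕ.n≤1+n _) (InSpan⇒∼ (sc i i′ i′≡i+1)))
              (≡.subst (λ m → f i′ ∼[ suc m ] 𝟎) i′≡i+1 (adapted-below (λ _ _ _ → refl) i′))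
      where
      i′ = fromℕ< i+1<n
      i′≡i+1 = toℕ-fromℕ< i+1<n
    ... | no  i+1≮n = ∼-top (ℕ.≤-trans (ℕ.≮⇒≥ i+1≮n) (ℕ.n≤1+n _))

    subcyclic-shift : ∀ {τ} → Subcyclic R τ f → ∀ {x y m} →
      x ∼[ m ] y → fun τ x ∼[ suc m ] fun τ y
    subcyclic-shift {τ} sc {x} {y} x∼y =
      ∼-trans (≋⇒∼ (τ-lc x))
        (∼-trans (lc-∼-triangular 1 (subcyclic-below {τ} sc) x∼y) (≋⇒∼ (≋-sym (τ-lc y))))
      where
      τ-lc : ∀ v → fun τ v ≋ lc (coord v) (fun τ ∘ f)
      τ-lc v = ≋-trans (cong τ (coord-spec v)) (End-lc τ (coord v) f)

  fsuc-follows-inject₁ : (i : Fin n) → toℕ (fsuc i) ≡.≡ suc (toℕ (inject₁ i))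
  fsuc-follows-inject₁ i = ≡.cong suc (≡.sym (toℕ-inject₁ i))

  module _ {n} {f : Frame R (suc n)} (f-basis : IsBasis R f) where
    open Flag {f = f} f-basis

    cyclic-adapted : ∀ {τ X} → Subcyclic R τ f → Cyclic R τ X → X fzero ∼[ 0 ] f fzero → Adapted X
    cyclic-adapted {τ} {X} τ-subcyclic X-cyclic X₀∼f₀ =
      <-weakInduction (λ j → X j ∼[ toℕ j ] f j) X₀∼f₀ step
      where
      step : ∀ i → X (inject₁ i) ∼[ toℕ (inject₁ i) ] f (inject₁ i) →
        X (fsuc i) ∼[ suc (toℕ i) ] f (fsuc i)
      step i Xᵢ∼fᵢ = ≡.subst (λ m → X (fsuc i) ∼[ suc m ] f (fsuc i)) (toℕ-inject₁ i)
        (∼-trans (≋⇒∼ (≋-sym (X-cyclic _ _ (fsuc-follows-inject₁ i))))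
          (∼-trans (subcyclic-shift {τ} τ-subcyclic Xᵢ∼fᵢ)
                   (InSpan⇒∼ (τ-subcyclic _ _ (fsuc-follows-inject₁ i)))))

    stabiliser-fixes-f₀ : ∀ {w} → InStab R f w → fun (to w) (f fzero) ≋ f fzero
    stabiliser-fixes-f₀ w-stabilises = ∼[0]⇒≋ (InSpan⇒∼ (w-stabilises fzero))

  Cyclic-resp : ∀ {σ : End R n} {X Y} → (∀ i → X i ≋ Y i) → Cyclic R σ X → Cyclic R σ Y
  Cyclic-resp {σ = σ} X≋Y X-cyclic i i′ i′≡i+1 =
    ≋-trans (cong σ (≋-sym (X≋Y i))) (≋-trans (X-cyclic i i′ i′≡i+1) (X≋Y i′))

  cyclic-unique : ∀ {τ : End R (suc n)} {X Y} → Cyclic R τ X → Cyclic R τ Y →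
    X fzero ≋ Y fzero → ∀ i → X i ≋ Y i
  cyclic-unique {τ = τ} {X} {Y} X-cyclic Y-cyclic X₀≋Y₀ =
    <-weakInduction (λ i → X i ≋ Y i) X₀≋Y₀ λ i Xᵢ≋Yᵢ →
      ≋-trans (≋-sym (X-cyclic _ _ (fsuc-follows-inject₁ i)))
              (≋-trans (cong τ Xᵢ≋Yᵢ) (Y-cyclic _ _ (fsuc-follows-inject₁ i)))

  orbit : End R n → Vect R n → Frame R n
  orbit τ v i = fold v (fun τ) (toℕ i)

  orbit-cyclic : (τ : End R n) (v : Vect R n) → Cyclic R τ (orbit τ v)
  orbit-cyclic τ v i i′ i′≡i+1 = ≋-reflexive (≡.cong (fold v (fun τ)) (≡.sym i′≡i+1))

  conjugate : Aut R n → End R n → End R n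
  conjugate u τ = to u ∘ᴱ τ ∘ᴱ from u

  conjugate-inConjClass : ∀ {f : Frame R n} (u : Aut R n) (τ : End R n) → InStab R f u →
    InConjClass R f τ (conjugate u τ)
  conjugate-inConjClass u τ u-stabilises = u , u-stabilises , λ _ → ≋-refl

  conjugate-cyclic : ∀ {u τ X} → Cyclic R τ (fun (from u) ∘ X) → Cyclic R (conjugate {n} u τ) X
  conjugate-cyclic {u = u} {X = X} cyc i i′ i′≡i+1 =
    ≋-trans (cong (to u) (cyc i i′ i′≡i+1)) (to∘from u (X i′))

  conjugate-cyclic⁻¹ : ∀ {u τ σ X} → _≈ₑ_ R σ (conjugate {n} u τ) →
    Cyclic R σ X → Cyclic R τ (fun (from u) ∘ X)
  conjugate-cyclic⁻¹ {u = u} {X = X} σ≈uτu⁻¹ σ-cyclic i i′ i′≡i+1 = ≋-trans (≋-sym (from∘to u _))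
    (cong (from u) (≋-trans (≋-sym (σ≈uτu⁻¹ (X i))) (σ-cyclic i i′ i′≡i+1)))

  from-≈ₑ⇒to-≈ₑ : ∀ {u w : Aut R n} → _≈ₑ_ R (from w) (from u) → _≈ₑ_ R (to w) (to u)
  from-≈ₑ⇒to-≈ₑ {u = u} {w} w⁻¹≈u⁻¹ x = begin
    fun (to w) x                              ≈⟨ to∘from u _ ⟨
    fun (to u) (fun (from u) (fun (to w) x))  ≈⟨ cong (to u) (w⁻¹≈u⁻¹ _) ⟨
    fun (to u) (fun (from w) (fun (to w) x))  ≈⟨ cong (to u) (from∘to w x) ⟩
    fun (to u) x                              ∎
    where open ≋-Reasoning

  conjugate-cong : ∀ {u w : Aut R n} {τ} → _≈ₑ_ R (from w) (from u) →
    _≈ₑ_ R (conjugate w τ) (conjugate u τ)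
  conjugate-cong {u = u} {w} {τ} w⁻¹≈u⁻¹ v =
    ≋-trans (from-≈ₑ⇒to-≈ₑ {u = u} {w} w⁻¹≈u⁻¹ _) (cong (to u) (cong τ (w⁻¹≈u⁻¹ v)))

  module CyclicNormalForm {n} {τ : End R (suc n)} {f B : Frame R (suc n)}
    (f-basis : IsBasis R f) (B-basis : IsBasis R B)
    (f~B : SameFlag R f B) (τ-subcyclic : Subcyclic R τ f) where
    open Flag {f = f} f-basis

    B-adapted : Adapted B
    B-adapted = sameFlag⇒adapted f~B

    e : Frame R (suc n)
    e = orbit τ (B fzero)

    e-adapted : Adapted e
    e-adapted = cyclic-adapted f-basis {τ} τ-subcyclic (orbit-cyclic τ (B fzero)) (B-adapted fzero)

    e-basis : IsBasis R e
    e-basis = adapted⇒isBasis {e} e-adapted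

    u : Aut R (suc n)
    u = basisChange {e = e} {B} e-basis B-basis

    u⁻¹B≋e : ∀ i → fun (from u) (B i) ≋ e i
    u⁻¹B≋e = Coordinates.extend-basis {e = B} B-basis e

    u-conjugates : InConjClass R f τ (conjugate u τ)
    u-conjugates =
      conjugate-inConjClass u τ (basisChange-stabilises {e} {B} e-basis B-basis e-adapted B-adapted)

    u-conjugate-cyclic : Cyclic R (conjugate u τ) B
    u-conjugate-cyclic = conjugate-cyclic {u = u} {τ} {B}
      (Cyclic-resp {σ = τ} {e} {fun (from u) ∘ B} (≋-sym ∘ u⁻¹B≋e) (orbit-cyclic τ (B fzero)))

    cyclic-conjugate-unique : ∀ σ → InConjClass R f τ σ → Cyclic R σ B → _≈ₑ_ R σ (conjugate u τ)
    cyclic-conjugate-unique σ (w , w-stabilises , σ≈wτw⁻¹) σ-cyclic v =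
      ≋-trans (σ≈wτw⁻¹ v) (conjugate-cong {u = u} {w} {τ} w⁻¹≈u⁻¹ v)
      where
      B₀≋f₀ : B fzero ≋ f fzero
      B₀≋f₀ = ∼[0]⇒≋ (B-adapted fzero)

      w⁻¹B₀≋B₀ : fun (from w) (B fzero) ≋ B fzero
      w⁻¹B₀≋B₀ = begin
        fun (from w) (B fzero)                 ≈⟨ cong (from w) B₀≋f₀ ⟩
        fun (from w) (f fzero)                 ≈⟨ cong (from w) (stabiliser-fixes-f₀ f-basis {w} w-stabilises) ⟨
        fun (from w) (fun (to w) (f fzero))    ≈⟨ from∘to w (f fzero) ⟩
        f fzero                                ≈⟨ B₀≋f₀ ⟨
        B fzero                                ∎
        where open ≋-Reasoning

      w⁻¹B≋e : ∀ i → fun (from w) (B i) ≋ e i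
      w⁻¹B≋e = cyclic-unique {τ = τ} {fun (from w) ∘ B} {e}
        (conjugate-cyclic⁻¹ {u = w} {τ} {σ} {B} σ≈wτw⁻¹ σ-cyclic) (orbit-cyclic τ (B fzero)) w⁻¹B₀≋B₀

      w⁻¹≈u⁻¹ : _≈ₑ_ R (from w) (from u)
      w⁻¹≈u⁻¹ = Coordinates.End-ext {e = B} B-basis (from w) (from u)
        (λ i → ≋-trans (w⁻¹B≋e i) (≋-sym (u⁻¹B≋e i)))

lemma3p7 : ∀ {c ℓ} (R : CommutativeRing c ℓ) (n : ℕ) (τ : End R n)
    (f B : Frame R n) → IsBasis R f → IsBasis R B →
    SameFlag R f B → Subcyclic R τ f →
    Σ (End R n) λ σ → InConjClass R f τ σ × Cyclic R σ B
    × (∀ (σ' : End R n) → InConjClass R f τ σ' → Cyclic R σ' B → _≈ₑ_ R σ' σ)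
lemma3p7 R zero τ f B f-basis _ _ _ =
  τ , (basisChange R {e = f} {f} f-basis f-basis , (λ ()) , λ _ ()) , (λ ()) , λ _ _ _ _ ()
lemma3p7 R (suc n) τ f B f-basis B-basis f~B τ-subcyclic =
  conjugate R u τ , u-conjugates , u-conjugate-cyclic , cyclic-conjugate-unique
  where open CyclicNormalForm R {τ = τ} f-basis B-basis f~B τ-subcyclic
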